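{- Let $G$ be a $(P_5,\textit{HVN})$-free graph and let $C=v_1v_2v_3v_4v_5v_1$ be an induced 5-cycle of $G$ (indices modulo 5). For $u\in V(G)$ let $N_C(u)$ be the set of neighbours of $u$ in $V(C)$, and for $i\in\{1,\dots,5\}$ define $S=\{u: N_C(u)=\emptyset\}$, $R_i=\{u: N_C(u)=\{v_{i-1},v_{i+1}\}\}$, $\bar R_i=\{u: N_C(u)=\{v_{i-1},v_i,v_{i+1}\}\}$, $Y_i=\{u: N_C(u)=\{v_{i-2},v_i,v_{i+2}\}\}$, $P^i=\{u: N_C(u)=\{v_{i-1},v_i,v_{i+1},v_{i+2}\}\}$, $T=\{u: N_C(u)=V(C)\}$. Then for each $1\le i\le 5$: (a) $T\cup\bigcup_{1\le j\le 5}P^j$ is stable, and $Y_i$ is stable; (b) $T$ is anticomplete to $\bar R_i$ and to $Y_i$; (c) $Y_i$ is anticomplete to $P^{i+1}$, $P^{i+2}$, $P^{i-2}$ and $\bar R_{i+2}\cup\bar R_{i-2}$; (d) $P^i$ is anticomplete to $\bar R_j$ for every $j\neq i-2$; (e) $R_i\cup\bar R_i$ is complete to $R_{i+1}\cup\bar R_{i+1}$; (f) either $\bar R_i=\emptyset$ or $\bar R_{i+1}=\emptyset$; (g) $S$ is anticomplete to $R_i\cup\bar R_i$.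
   Context: Throughout, graphs are finite, simple and connected. $P_5$ is the path on 5 vertices. An HVN is a $K_4$ together with one additional vertex adjacent to exactly two vertices of the $K_4$. A graph is $(H_1,H_2)$-free if it contains neither $H_1$ nor $H_2$ as an induced subgraph. A set is stable if it induces no edges. A set $A$ is complete (anticomplete) to a set $B$ if every vertex of $A$ is adjacent to every (no) vertex of $B$. -}

module Defs where

open import Data.Nat using (ℕ; zero; suc)
open import Data.Bool using (Bool; true; false; _∨_; _∧_; not)
open import Data.Fin using (Fin; zero; suc; toℕ; _≟_)
open import Data.Product using (Σ; _×_; _,_)
open import Data.Sum using (_⊎_)
open import Function.Definitions using (Injective)
open import Relation.Binary.PropositionalEquality using (_≡_)
open import Relation.Nullary using (¬_)
open import Relation.Nullary.Decidable using (⌊_⌋)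

record Graph : Set where
  field
    n      : ℕ
    adj    : Fin n → Fin n → Bool
    sym    : ∀ x y → adj x y ≡ adj y x
    irrefl : ∀ x → adj x x ≡ false
open Graph public

data Reach (G : Graph) : Fin (n G) → Fin (n G) → Set where
  here : ∀ {x} → Reach G x x
  step : ∀ {x y z} → adj G x y ≡ true → Reach G y z → Reach G x z

Connected : Graph → Set
Connected G = ∀ x y → Reach G x y

ContainsInduced : (G : Graph) (k : ℕ) → (Fin k → Fin k → Bool) → Set
ContainsInduced G k H =
  Σ (Fin k → Fin (n G)) λ f →
    Injective _≡_ _≡_ f × (∀ a b → H a b ≡ adj G (f a) (f b))

_==ℕ_ : ℕ → ℕ → Bool
zero  ==ℕ zero  = true
zero  ==ℕ suc _ = false
suc _ ==ℕ zero  = false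
suc a ==ℕ suc b = a ==ℕ b

_==_ : ∀ {k} → Fin k → Fin k → Bool
a == b = ⌊ a ≟ b ⌋

P5 : Fin 5 → Fin 5 → Bool
P5 a b = (toℕ a ==ℕ suc (toℕ b)) ∨ (toℕ b ==ℕ suc (toℕ a))

-- HVN: K4 on {0,1,2,3}, plus vertex 4 adjacent exactly to 0 and 1
inK4 : ℕ → Bool
inK4 m = (m ==ℕ 0) ∨ (m ==ℕ 1) ∨ (m ==ℕ 2) ∨ (m ==ℕ 3)

hub : ℕ → Bool
hub m = (m ==ℕ 0) ∨ (m ==ℕ 1)

HVN : Fin 5 → Fin 5 → Bool
HVN a b =
  (inK4 (toℕ a) ∧ inK4 (toℕ b) ∧ not (a == b))
  ∨ ((toℕ a ==ℕ 4) ∧ hub (toℕ b))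
  ∨ ((toℕ b ==ℕ 4) ∧ hub (toℕ a))

succ5 : Fin 5 → Fin 5
succ5 zero = suc zero
succ5 (suc zero) = suc (suc zero)
succ5 (suc (suc zero)) = suc (suc (suc zero))
succ5 (suc (suc (suc zero))) = suc (suc (suc (suc zero)))
succ5 (suc (suc (suc (suc zero)))) = zero

pred5 : Fin 5 → Fin 5
pred5 zero = suc (suc (suc (suc zero)))
pred5 (suc zero) = zero
pred5 (suc (suc zero)) = suc zero
pred5 (suc (suc (suc zero))) = suc (suc zero)
pred5 (suc (suc (suc (suc zero)))) = suc (suc (suc zero))

C5 : Fin 5 → Fin 5 → Bool
C5 i j = (j == succ5 i) ∨ (j == pred5 i)

VSet : Graph → Set₁
VSet G = Fin (n G) → Set

Union : (G : Graph) → VSet G → VSet G → VSet G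
Union G A B u = A u ⊎ B u

Stable : (G : Graph) → VSet G → Set
Stable G A = ∀ x y → A x → A y → adj G x y ≡ false

Complete : (G : Graph) → VSet G → VSet G → Set
Complete G A B = ∀ x y → A x → B y → adj G x y ≡ true

Anticomplete : (G : Graph) → VSet G → VSet G → Set
Anticomplete G A B = ∀ x y → A x → B y → adj G x y ≡ false

Empty : (G : Graph) → VSet G → Set
Empty G A = ∀ u → ¬ A u

-- Attachment classes w.r.t. a 5-cycle v : Fin 5 → V(G)
-- NCis G v X u  :  N_C(u) = { v_j : X j ≡ true }

NCis : (G : Graph) → (Fin 5 → Fin (n G)) → (Fin 5 → Bool) → VSet G
NCis G v X u = ∀ j → adj G u (v j) ≡ X j

module Classes (G : Graph) (v : Fin 5 → Fin (n G)) where
  S : VSet G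
  S = NCis G v (λ j → false)

  R : Fin 5 → VSet G
  R i = NCis G v (λ j → (j == pred5 i) ∨ (j == succ5 i))

  Rbar : Fin 5 → VSet G
  Rbar i = NCis G v (λ j → (j == pred5 i) ∨ (j == i) ∨ (j == succ5 i))

  Y : Fin 5 → VSet G
  Y i = NCis G v (λ j → (j == pred5 (pred5 i)) ∨ (j == i) ∨ (j == succ5 (succ5 i)))

  P : Fin 5 → VSet G
  P i = NCis G v (λ j → (j == pred5 i) ∨ (j == i) ∨ (j == succ5 i) ∨ (j == succ5 (succ5 i)))

  T : VSet G
  T = NCis G v (λ j → true)

  TP : VSet G
  TP u = T u ⊎ Σ (Fin 5) (λ j → P j u)

-- Every clause concerns two vertices x, y whose neighbourhoods on C and whose
-- mutual adjacency are prescribed, so together with C they induce a fixed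
-- 7-vertex graph; in each case that graph contains an induced P5 or HVN.  An
-- explicit copy is found by a finite search and transported to G.  The copy's
-- vertices need not be distinct a priori, but P5 and HVN have no non-adjacent
-- twins, so any adjacency-preserving-and-reflecting map from them is injective.

module Submission where

open import Defs
open import Data.Bool using (Bool; true; false; _∨_; _∧_; not; _xor_)
import Data.Bool.Properties as Bool
open import Data.Empty using (⊥-elim)
open import Data.Fin using (Fin; zero; suc)
import Data.Fin.Properties as Fin
open import Data.List using (List; []; _∷_; _++_; map; concatMap; filterᵇ; allFin)
open import Data.Bool.ListAction using (all)
open import Data.List.Relation.Unary.Any using (Any; any?; satisfied)
open import Data.Nat using (ℕ)
open import Data.Product using (_×_; _,_)
open import Data.Sum using (_⊎_; inj₁; inj₂; [_,_]′)
import Data.Vec.Functional as Vector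
open import Function.Definitions using (Injective)
open import Relation.Binary.PropositionalEquality using (_≡_; _≢_; trans; cong) renaming (sym to ≡-sym)
open import Relation.Nullary using (¬_; Dec; yes; no)
open import Relation.Nullary.Decidable using (from-yes; _×-dec_; _⊎-dec_; _→-dec_)

private
  variable
    U V W : Set
    k : ℕ

IsInducedMap : (U → U → Bool) → (V → V → Bool) → (U → V) → Set
IsInducedMap H A f = ∀ a b → H a b ≡ A (f a) (f b)

isInducedMap? : (H : Fin k → Fin k → Bool) (A : V → V → Bool) (f : Fin k → V) →
                Dec (IsInducedMap H A f)
isInducedMap? H A f = Fin.all? λ a → Fin.all? λ b → H a b Bool.≟ A (f a) (f b)

isInducedMap-∘ : ∀ {H : U → U → Bool} {A : V → V → Bool} (B : W → W → Bool) {f : U → V} {g : V → W} →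
                 IsInducedMap H A f → IsInducedMap A B g → IsInducedMap H B (λ a → g (f a))
isInducedMap-∘ B {f = f} f-induced g-induced a b = trans (f-induced a b) (g-induced (f a) (f b))

TwinFree : (Fin k → Fin k → Bool) → Set
TwinFree H = ∀ a b → (∀ c → H a c ≡ H b c) → H a b ≡ false → a ≡ b

twinFree? : (H : Fin k → Fin k → Bool) → Dec (TwinFree H)
twinFree? H = Fin.all? λ a → Fin.all? λ b →
  Fin.all? (λ c → H a c Bool.≟ H b c) →-dec (H a b Bool.≟ false) →-dec (a Fin.≟ b)

twinFree-P5 : TwinFree P5
twinFree-P5 = from-yes (twinFree? P5)

twinFree-HVN : TwinFree HVN
twinFree-HVN = from-yes (twinFree? HVN)

containsInduced-of-twinFree : (G : Graph) {H : Fin k → Fin k → Bool} → TwinFree H →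
                              (f : Fin k → Fin (n G)) → IsInducedMap H (adj G) f →
                              ContainsInduced G k H
containsInduced-of-twinFree G {H} twinFree f f-induced = f , injective , f-induced
  where
  injective : Injective _≡_ _≡_ f
  injective {a} {b} fa≡fb = twinFree a b
    (λ c → trans (f-induced a c) (trans (cong (λ z → adj G z (f c)) fa≡fb) (≡-sym (f-induced b c))))
    (trans (f-induced a b) (trans (cong (λ z → adj G z (f b)) fa≡fb) (irrefl G (f b))))

extendsInducedMap : (H : Fin (ℕ.suc k) → Fin (ℕ.suc k) → Bool) (A : V → V → Bool) → V → (Fin k → V) → Bool
extendsInducedMap {k = k} H A u f =
  agrees (H zero zero) (A u u)
  ∧ all (λ a → agrees (H zero (suc a)) (A u (f a)) ∧ agrees (H (suc a) zero) (A (f a) u)) (allFin k)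
  where
  agrees : Bool → Bool → Bool
  agrees b c = not (b xor c)

-- The search is not proved correct: only the candidates it returns are used,
-- and each of them is checked again by isInducedMap?.
inducedMapCandidates : (H : Fin k → Fin k → Bool) (A : V → V → Bool) → List V → List (Fin k → V)
inducedMapCandidates {k = ℕ.zero}  H A vs = (λ ()) ∷ []
inducedMapCandidates {k = ℕ.suc k} H A vs =
  concatMap (λ f → map (Vector._∷ f) (filterᵇ (λ u → extendsInducedMap H A u f) vs))
            (inducedMapCandidates (λ a b → H (suc a) (suc b)) A vs)

data Config : Set where
  cyc : Fin 5 → Config
  x y : Config

configVertices : List Config
configVertices = map cyc (allFin 5) ++ x ∷ y ∷ []

configAdj : (px py : Fin 5 → Bool) → Bool → Config → Config → Bool
configAdj px py b (cyc i) (cyc j) = C5 i j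
configAdj px py b (cyc j) x       = px j
configAdj px py b (cyc j) y       = py j
configAdj px py b x       (cyc j) = px j
configAdj px py b y       (cyc j) = py j
configAdj px py b x       x       = false
configAdj px py b y       y       = false
configAdj px py b x       y       = b
configAdj px py b y       x       = b

InConfig : (Fin 5 → Fin 5 → Bool) → (px py : Fin 5 → Bool) → Bool → Set
InConfig H px py b = Any (IsInducedMap H (configAdj px py b))
                         (inducedMapCandidates H (configAdj px py b) configVertices)

Forbidden : (px py : Fin 5 → Bool) → Bool → Set
Forbidden px py b = InConfig P5 px py b ⊎ InConfig HVN px py b

forbidden? : (px py : Fin 5 → Bool) (b : Bool) → Dec (Forbidden px py b)
forbidden? px py b = inConfig? P5 ⊎-dec inConfig? HVN
  where
  inConfig? : (H : Fin 5 → Fin 5 → Bool) → Dec (InConfig H px py b)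
  inConfig? H = any? (isInducedMap? H (configAdj px py b)) _

rPattern rbarPattern yPattern pPattern : Fin 5 → Fin 5 → Bool
rPattern    i j = (j == pred5 i) ∨ (j == succ5 i)
rbarPattern i j = (j == pred5 i) ∨ (j == i) ∨ (j == succ5 i)
yPattern    i j = (j == pred5 (pred5 i)) ∨ (j == i) ∨ (j == succ5 (succ5 i))
pPattern    i j = (j == pred5 i) ∨ (j == i) ∨ (j == succ5 i) ∨ (j == succ5 (succ5 i))

tPattern : Fin 5 → Bool
tPattern j = true

sPattern : Fin 5 → Bool
sPattern j = false

forbidden-T-T : Forbidden tPattern tPattern true
forbidden-T-T = from-yes (forbidden? tPattern tPattern true)

forbidden-T-P : ∀ j → Forbidden tPattern (pPattern j) true
forbidden-T-P = from-yes (Fin.all? λ j → forbidden? tPattern (pPattern j) true)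

forbidden-P-T : ∀ i → Forbidden (pPattern i) tPattern true
forbidden-P-T = from-yes (Fin.all? λ i → forbidden? (pPattern i) tPattern true)

forbidden-P-P : ∀ i j → Forbidden (pPattern i) (pPattern j) true
forbidden-P-P = from-yes (Fin.all? λ i → Fin.all? λ j → forbidden? (pPattern i) (pPattern j) true)

forbidden-Y-Y : ∀ i → Forbidden (yPattern i) (yPattern i) true
forbidden-Y-Y = from-yes (Fin.all? λ i → forbidden? (yPattern i) (yPattern i) true)

forbidden-T-Rbar : ∀ i → Forbidden tPattern (rbarPattern i) true
forbidden-T-Rbar = from-yes (Fin.all? λ i → forbidden? tPattern (rbarPattern i) true)

forbidden-T-Y : ∀ i → Forbidden tPattern (yPattern i) true
forbidden-T-Y = from-yes (Fin.all? λ i → forbidden? tPattern (yPattern i) true)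

forbidden-Y-P : ∀ i → Forbidden (yPattern i) (pPattern (succ5 i)) true
                    × Forbidden (yPattern i) (pPattern (succ5 (succ5 i))) true
                    × Forbidden (yPattern i) (pPattern (pred5 (pred5 i))) true
forbidden-Y-P = from-yes (Fin.all? λ i →
  forbidden? (yPattern i) (pPattern (succ5 i)) true
  ×-dec forbidden? (yPattern i) (pPattern (succ5 (succ5 i))) true
  ×-dec forbidden? (yPattern i) (pPattern (pred5 (pred5 i))) true)

forbidden-Y-Rbar : ∀ i → Forbidden (yPattern i) (rbarPattern (succ5 (succ5 i))) true
                       × Forbidden (yPattern i) (rbarPattern (pred5 (pred5 i))) true
forbidden-Y-Rbar = from-yes (Fin.all? λ i →
  forbidden? (yPattern i) (rbarPattern (succ5 (succ5 i))) true
  ×-dec forbidden? (yPattern i) (rbarPattern (pred5 (pred5 i))) true)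

forbidden-P-Rbar : ∀ i j → j ≡ pred5 (pred5 i) ⊎ Forbidden (pPattern i) (rbarPattern j) true
forbidden-P-Rbar = from-yes (Fin.all? λ i → Fin.all? λ j →
  j Fin.≟ pred5 (pred5 i) ⊎-dec forbidden? (pPattern i) (rbarPattern j) true)

forbidden-consecutive-nonadjacent :
  ∀ i → Forbidden (rPattern i) (rPattern (succ5 i)) false
      × Forbidden (rPattern i) (rbarPattern (succ5 i)) false
      × Forbidden (rbarPattern i) (rPattern (succ5 i)) false
      × Forbidden (rbarPattern i) (rbarPattern (succ5 i)) false
forbidden-consecutive-nonadjacent = from-yes (Fin.all? λ i →
  forbidden? (rPattern i) (rPattern (succ5 i)) false
  ×-dec forbidden? (rPattern i) (rbarPattern (succ5 i)) false
  ×-dec forbidden? (rbarPattern i) (rPattern (succ5 i)) false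
  ×-dec forbidden? (rbarPattern i) (rbarPattern (succ5 i)) false)

forbidden-Rbar-Rbar : ∀ i → Forbidden (rbarPattern i) (rbarPattern (succ5 i)) true
                          × Forbidden (rbarPattern i) (rbarPattern (succ5 i)) false
forbidden-Rbar-Rbar = from-yes (Fin.all? λ i →
  forbidden? (rbarPattern i) (rbarPattern (succ5 i)) true
  ×-dec forbidden? (rbarPattern i) (rbarPattern (succ5 i)) false)

forbidden-S-R : ∀ i → Forbidden sPattern (rPattern i) true × Forbidden sPattern (rbarPattern i) true
forbidden-S-R = from-yes (Fin.all? λ i →
  forbidden? sPattern (rPattern i) true ×-dec forbidden? sPattern (rbarPattern i) true)

module _ (G : Graph) where

  anticomplete-∪ʳ : ∀ {A B C} → Anticomplete G A B → Anticomplete G A C → Anticomplete G A (Union G B C)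
  anticomplete-∪ʳ A-B A-C u w hu (inj₁ hw) = A-B u w hu hw
  anticomplete-∪ʳ A-B A-C u w hu (inj₂ hw) = A-C u w hu hw

  complete-∪ : ∀ {A B C D} → Complete G A C → Complete G A D → Complete G B C → Complete G B D →
               Complete G (Union G A B) (Union G C D)
  complete-∪ A-C A-D B-C B-D u w (inj₁ hu) (inj₁ hw) = A-C u w hu hw
  complete-∪ A-C A-D B-C B-D u w (inj₁ hu) (inj₂ hw) = A-D u w hu hw
  complete-∪ A-C A-D B-C B-D u w (inj₂ hu) (inj₁ hw) = B-C u w hu hw
  complete-∪ A-C A-D B-C B-D u w (inj₂ hu) (inj₂ hw) = B-D u w hu hw

module ForbiddenConfigurations
  (G : Graph) (P5-free : ¬ ContainsInduced G 5 P5) (HVN-free : ¬ ContainsInduced G 5 HVN)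
  (v : Fin 5 → Fin (n G)) (v-induced : IsInducedMap C5 (adj G) v) where

  configMap : Fin (n G) → Fin (n G) → Config → Fin (n G)
  configMap u w (cyc j) = v j
  configMap u w x       = u
  configMap u w y       = w

  configMap-induced : ∀ {px py b u w} → NCis G v px u → NCis G v py w → adj G u w ≡ b →
                      IsInducedMap (configAdj px py b) (adj G) (configMap u w)
  configMap-induced hu hw uw (cyc i) (cyc j) = v-induced i j
  configMap-induced {u = u} hu hw uw (cyc j) x = trans (≡-sym (hu j)) (Graph.sym G u (v j))
  configMap-induced {w = w} hu hw uw (cyc j) y = trans (≡-sym (hw j)) (Graph.sym G w (v j))
  configMap-induced hu hw uw x (cyc j) = ≡-sym (hu j)
  configMap-induced hu hw uw y (cyc j) = ≡-sym (hw j)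
  configMap-induced {u = u} hu hw uw x x = ≡-sym (irrefl G u)
  configMap-induced {w = w} hu hw uw y y = ≡-sym (irrefl G w)
  configMap-induced hu hw uw x y = ≡-sym uw
  configMap-induced {u = u} {w} hu hw uw y x = trans (≡-sym uw) (Graph.sym G u w)

  not-inConfig : ∀ {H px py b u w} → ¬ ContainsInduced G 5 H → TwinFree H → InConfig H px py b →
                 NCis G v px u → NCis G v py w → adj G u w ≢ b
  not-inConfig {u = u} {w} H-free twinFree found hu hw uw with satisfied found
  ... | f , f-induced = H-free (containsInduced-of-twinFree G twinFree (λ a → configMap u w (f a))
                                 (isInducedMap-∘ (adj G) {f = f} f-induced (configMap-induced hu hw uw)))

  not-forbidden : ∀ {px py b u w} → Forbidden px py b →
                  NCis G v px u → NCis G v py w → adj G u w ≢ b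
  not-forbidden (inj₁ found) = not-inConfig P5-free twinFree-P5 found
  not-forbidden (inj₂ found) = not-inConfig HVN-free twinFree-HVN found

  anticomplete : ∀ {px py} → Forbidden px py true → Anticomplete G (NCis G v px) (NCis G v py)
  anticomplete forbidden u w hu hw = Bool.¬-not (not-forbidden forbidden hu hw)

  complete : ∀ {px py} → Forbidden px py false → Complete G (NCis G v px) (NCis G v py)
  complete forbidden u w hu hw = Bool.¬-not (not-forbidden forbidden hu hw)

  one-empty : ∀ {px py} → Forbidden px py true → Forbidden px py false →
              Empty G (NCis G v px) ⊎ Empty G (NCis G v py)
  one-empty {px} adjacent nonadjacent with Fin.any? (λ u → Fin.all? λ j → adj G u (v j) Bool.≟ px j)
  ... | yes (u , hu) = inj₂ λ w hw → not-forbidden nonadjacent hu hw (Bool.¬-not (not-forbidden adjacent hu hw))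
  ... | no  none     = inj₁ λ u hu → none (u , hu)

  stable-TP : Stable G (Classes.TP G v)
  stable-TP u w (inj₁ hu) (inj₁ hw) = anticomplete forbidden-T-T u w hu hw
  stable-TP u w (inj₁ hu) (inj₂ (j , hw)) = anticomplete (forbidden-T-P j) u w hu hw
  stable-TP u w (inj₂ (i , hu)) (inj₁ hw) = anticomplete (forbidden-P-T i) u w hu hw
  stable-TP u w (inj₂ (i , hu)) (inj₂ (j , hw)) = anticomplete (forbidden-P-P i j) u w hu hw

lemma2p6 : (G : Graph) → Connected G
    → ¬ ContainsInduced G 5 P5 → ¬ ContainsInduced G 5 HVN
    → (v : Fin 5 → Fin (n G)) → Injective _≡_ _≡_ v
    → (∀ a b → C5 a b ≡ adj G (v a) (v b))
    → (i : Fin 5)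
    → let open Classes G v in
      (Stable G TP × Stable G (Y i))
      × (Anticomplete G T (Rbar i) × Anticomplete G T (Y i))
      × (Anticomplete G (Y i) (P (succ5 i)) × Anticomplete G (Y i) (P (succ5 (succ5 i)))
         × Anticomplete G (Y i) (P (pred5 (pred5 i)))
         × Anticomplete G (Y i) (Union G (Rbar (succ5 (succ5 i))) (Rbar (pred5 (pred5 i)))))
      × (∀ j → ¬ j ≡ pred5 (pred5 i) → Anticomplete G (P i) (Rbar j))
      × Complete G (Union G (R i) (Rbar i)) (Union G (R (succ5 i)) (Rbar (succ5 i)))
      × (Empty G (Rbar i) ⊎ Empty G (Rbar (succ5 i)))
      × Anticomplete G S (Union G (R i) (Rbar i))
lemma2p6 G _ P5-free HVN-free v _ v-induced i =
  let (Y-P₁ , Y-P₂ , Y-P₃) = forbidden-Y-P i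
      (Y-Rbar₁ , Y-Rbar₂) = forbidden-Y-Rbar i
      (R-R , R-Rbar , Rbar-R , Rbar-Rbar) = forbidden-consecutive-nonadjacent i
      (Rbar-Rbar-adjacent , Rbar-Rbar-nonadjacent) = forbidden-Rbar-Rbar i
      (S-R , S-Rbar) = forbidden-S-R i
  in  (stable-TP , anticomplete (forbidden-Y-Y i))
    , (anticomplete (forbidden-T-Rbar i) , anticomplete (forbidden-T-Y i))
    , (anticomplete Y-P₁ , anticomplete Y-P₂ , anticomplete Y-P₃
      , anticomplete-∪ʳ G (anticomplete Y-Rbar₁) (anticomplete Y-Rbar₂))
    , P-Rbar
    , complete-∪ G (complete R-R) (complete R-Rbar) (complete Rbar-R) (complete Rbar-Rbar)
    , one-empty Rbar-Rbar-adjacent Rbar-Rbar-nonadjacent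
    , anticomplete-∪ʳ G (anticomplete S-R) (anticomplete S-Rbar)
  where
  open ForbiddenConfigurations G P5-free HVN-free v v-induced

  P-Rbar : ∀ j → j ≢ pred5 (pred5 i) → Anticomplete G (Classes.P G v i) (Classes.Rbar G v j)
  P-Rbar j j≢ = [ (λ j≡ → ⊥-elim (j≢ j≡)) , anticomplete ]′ (forbidden-P-Rbar i j)
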